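{- If a graph or a digraph with $n$ vertices and $m$ edges (or arcs) has an orientable bi-eulerian embedding, then the number of its vertices of degree congruent to $0$ mod $4$ is even (equivalently, $m-n$ is even).
   Context: Graphs and digraphs are finite and may have loops and multiple edges/arcs; the degree of a vertex in a digraph is its total degree. An euler circuit of a graph is a circuit using every edge and vertex; for a digraph, a directed euler circuit is a directed circuit using every arc and vertex. Embeddings are cellular in closed surfaces. A bi-eulerian embedding of a graph is an embedding with exactly two faces each bounded by an euler circuit; a bi-eulerian embedding of a digraph is an embedding with exactly two faces each bounded by a directed euler circuit. -}

module Defs where

open import Data.Nat using (ℕ; zero; suc; _+_; _%_)
open import Data.Nat.Divisibility using (_∣_)
open import Data.Fin using (Fin)
open import Data.Bool using (Bool; true; false; not)
open import Data.Product using (Σ; ∃; _×_; _,_; proj₁; proj₂)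
open import Data.Sum using (_⊎_)
open import Relation.Nullary using (¬_; yes; no)
open import Relation.Binary.PropositionalEquality using (_≡_)
open import Data.List using (List; length; filter)
open import Data.List using (allFin) renaming (map to lmap)
open import Data.Nat.ListAction using (sum)
open import Data.Fin.Properties using (_≟_)
open import Data.Nat using () renaming (_≟_ to _≟ℕ_)

-- A finite graph (loops and multiple edges allowed) with vertex set Fin n
-- and edge set Fin m.
-- The same data is read as a digraph: arc e goes from its tail
-- ends e false  to its head  ends e true.
record Graph : Set where
  field
    n    : ℕ
    m    : ℕ
    ends : Fin m → Bool → Fin n
open Graph public

-- Darts (half-edges): (e , b) is the end b of edge e.
Dart : Graph → Set
Dart G = Fin (m G) × Bool

base : (G : Graph) → Dart G → Fin (n G)
base G (e , b) = ends G e b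

θ : (G : Graph) → Dart G → Dart G
θ G (e , b) = (e , not b)

iter : {A : Set} → ℕ → (A → A) → A → A
iter zero    f x = x
iter (suc k) f x = f (iter k f x)

-- Orientable (cellular) embeddings of a graph, given combinatorially by a
-- rotation system: a permutation ρ of the darts which maps every dart to a
-- dart at the same vertex and whose orbits are exactly the sets of darts at
-- each vertex (the cyclic local rotations).
record RotationSystem (G : Graph) : Set where
  field
    ρ        : Dart G → Dart G
    ρ⁻¹      : Dart G → Dart G
    ρ-inv₁   : ∀ d → ρ⁻¹ (ρ d) ≡ d
    ρ-inv₂   : ∀ d → ρ (ρ⁻¹ d) ≡ d
    ρ-local  : ∀ d → base G (ρ d) ≡ base G d
    ρ-cyclic : ∀ d d' → base G d ≡ base G d' → ∃ λ k → iter k ρ d ≡ d'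
open RotationSystem public

module _ {G : Graph} (R : RotationSystem G) where

  -- face permutation: traverse the edge of dart d (from base d to the other
  -- end), then turn to the next dart in the rotation there.
  φ : Dart G → Dart G
  φ d = ρ R (θ G d)

  SameFace : Dart G → Dart G → Set
  SameFace d d' = ∃ λ k → iter k φ d ≡ d'

  TwoFaces : Dart G → Dart G → Set
  TwoFaces d₁ d₂ = ¬ SameFace d₁ d₂ × (∀ d → SameFace d₁ d ⊎ SameFace d₂ d)

  -- the boundary walk of the face of d (the closed walk d, φ d, φ² d, …,
  -- traversing dart (e , b) from  ends e b  to  ends e (not b)) is an euler
  -- circuit: it uses every edge exactly once and passes every vertex.
  EulerFace : Dart G → Set
  EulerFace d =
      (∀ e → (SameFace d (e , false) × ¬ SameFace d (e , true))
           ⊎ (SameFace d (e , true) × ¬ SameFace d (e , false)))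
    × (∀ v → ∃ λ d' → SameFace d d' × base G d' ≡ v)

  -- the boundary of the face of d is a directed euler circuit (read in one of
  -- its two directions): it is an euler circuit and all its darts traverse
  -- their arcs consistently in the same sense (all forward, or all backward).
  DirectedEulerFace : Dart G → Set
  DirectedEulerFace d =
    EulerFace d × ∃ λ b → ∀ e c → SameFace d (e , c) → c ≡ b

OrientableBiEulerian : Graph → Set
OrientableBiEulerian G =
  Σ (RotationSystem G) λ R → Σ (Dart G) λ d₁ → Σ (Dart G) λ d₂ →
    TwoFaces R d₁ d₂ × EulerFace R d₁ × EulerFace R d₂

OrientableDirectedBiEulerian : Graph → Set
OrientableDirectedBiEulerian G =
  Σ (RotationSystem G) λ R → Σ (Dart G) λ d₁ → Σ (Dart G) λ d₂ →
    TwoFaces R d₁ d₂ × DirectedEulerFace R d₁ × DirectedEulerFace R d₂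

-- (total) degree: number of darts at v; a loop contributes 2
degree : (G : Graph) → Fin (n G) → ℕ
degree G v = sum (lmap (λ e → endAt e false + endAt e true) (allFin (m G)))
  where
    endAt : Fin (m G) → Bool → ℕ
    endAt e b with ends G e b ≟ v
    ... | yes _ = 1
    ... | no  _ = 0

count0mod4 : Graph → ℕ
count0mod4 G = length (filter (λ v → degree G v % 4 ≟ℕ 0) (allFin (n G)))

-- conclusion: the count is even, and (equivalently) m - n is even,
-- i.e. m and n have the same parity
Conclusion : Graph → Set
Conclusion G = (2 ∣ count0mod4 G) × (2 ∣ m G + n G)

module Submission where

-- Let ρ be the rotation of an orientable embedding, θ the involution exchanging the two
-- darts of each edge, and φ = ρ ∘ θ its face permutation. Composing an injective map with
-- a transposition changes its number of orbits by exactly one, and θ is a product of m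
-- disjoint transpositions; as ρ has n orbits and φ has 2, n + m is even.
-- If a face is bounded by an euler circuit, it carries exactly one dart of every edge, and
-- the circuit leaves each vertex v as often as it enters it: deg v = 2 k(v), where k(v)
-- counts the edges whose face dart starts at v, and Σ k(v) = m. So deg v ≡ 0 (mod 4)
-- exactly when k(v) is even, and the number of such vertices is ≡ n − m ≡ 0 (mod 2).
-- Only one eulerian face is needed, and a directed euler circuit is in particular an
-- euler circuit.

open import Defs
open import Data.Bool using (Bool; true; false; not)
open import Data.Bool.Properties using (not-involutive)
open import Data.Empty using (⊥-elim)
open import Data.Fin using (Fin; toℕ; fromℕ<; punchOut; punchIn) renaming (zero to fzero; suc to fsuc)
open import Data.Fin.Permutation using (Permutation′; permutation)
open import Data.Fin.Properties
  using (pigeonhole; cantor-schröder-bernstein; toℕ-fromℕ<; toℕ<n; toℕ-injective; any?; ¬Fin0;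
         suc-injective; 0≢1+n; punchOut-cong; punchOut-injective; punchOut-punchIn; punchInᵢ≢i;
         2↔Bool; *↔×)
  renaming (_≟_ to _≟ᶠ_)
open import Data.List using ([]; _∷_; length; filter; map; tabulate; allFin)
open import Data.List.Properties using (length-tabulate; map-tabulate)
open import Data.Nat using (ℕ; zero; suc; _+_; _*_; _∸_; _%_; _≤_; _<_; z≤n; s≤s; parity)
  renaming (_≟_ to _≟ℕ_)
open import Data.Nat.DivMod using ([m+n]%n≡m%n)
open import Data.Nat.Divisibility using (_∣_; divides)
open import Data.Nat.ListAction using (sum)
open import Data.Nat.Properties
  using (+-comm; +-assoc; +-suc; +-identityʳ; *-suc; m∸n+n≡m; m<m+n; ≤-refl; ≤-reflexive; ≤-pred; <⇒≤;
         <-irrefl; m<1+n⇒m<n∨m≡n; m≤n⇒m<n∨m≡n; +-0-commutativeMonoid)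
open import Algebra.Properties.CommutativeMonoid.Sum +-0-commutativeMonoid
  using (sum-cong-≗; sum-replicate-zero; ∑-distrib-+; ∑-comm; sum-permute) renaming (sum to ∑)
open import Data.Parity.Base using (0ℙ; 1ℙ) renaming (_+_ to _+ℙ_)
open import Data.Parity.Properties using (+-homo-+)
open import Data.Product using (Σ; ∃; _×_; _,_; proj₁; proj₂)
open import Data.Product.Function.NonDependent.Propositional using (_×-↔_)
open import Data.Sum using (_⊎_; inj₁; inj₂)
open import Function using (id; _∘_; Injective; _↣_; _⇔_; mk⇔; Equivalence; Injection)
open import Function.Properties.Inverse using (↔⇒↣; ↔-trans; ↔-refl; ↔-sym)
open import Relation.Binary.Definitions using (DecidableEquality)
open import Relation.Binary.PropositionalEquality
  using (_≡_; _≢_; _≗_; refl; sym; trans; cong; cong₂; subst; module ≡-Reasoning)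
open import Relation.Nullary using (¬_; Dec; yes; no)
open import Relation.Nullary.Decidable using (via-injection)

-- Orbits of a self-map

module _ {X : Set} where

  iter-+ : (f : X → X) (p q : ℕ) (x : X) → iter (p + q) f x ≡ iter p f (iter q f x)
  iter-+ f zero    q x = refl
  iter-+ f (suc p) q x = cong f (iter-+ f p q x)

  iter-suc : (f : X → X) (k : ℕ) (x : X) → iter (suc k) f x ≡ iter k f (f x)
  iter-suc f k x = trans (cong (λ t → iter t f x) (+-comm 1 k)) (iter-+ f k 1 x)

  iter-cong : {f g : X → X} → f ≗ g → ∀ k x → iter k f x ≡ iter k g x
  iter-cong f≗g zero    x = refl
  iter-cong {f} f≗g (suc k) x = trans (cong f (iter-cong f≗g k x)) (f≗g _)

  iter-injective : {f : X → X} → Injective _≡_ _≡_ f → ∀ k {x y} → iter k f x ≡ iter k f y → x ≡ y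
  iter-injective f-inj zero    eq = eq
  iter-injective f-inj (suc k) eq = iter-injective f-inj k (f-inj eq)

  Reach : (X → X) → X → X → Set
  Reach f x y = ∃ λ k → iter k f x ≡ y

  module _ {f : X → X} where

    reach-refl : ∀ {x} → Reach f x x
    reach-refl = 0 , refl

    reach-step : ∀ {x y} → Reach f x y → Reach f x (f y)
    reach-step (k , eq) = suc k , cong f eq

    reach-trans : ∀ {x y z} → Reach f x y → Reach f y z → Reach f x z
    reach-trans {x} (k , refl) (l , refl) = l + k , iter-+ f l k x

    reach-invariant : {Y : Set} (h : X → Y) → (∀ z → h (f z) ≡ h z) → ∀ {x y} → Reach f x y → h x ≡ h y
    reach-invariant h h-inv {x} (k , refl) = sym (go k)
      where
        go : ∀ k → h (iter k f x) ≡ h x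
        go zero    = refl
        go (suc k) = trans (h-inv _) (go k)

  reach-cong : {f g : X → X} → f ≗ g → ∀ {x y} → Reach f x y → Reach g x y
  reach-cong f≗g {x} (k , eq) = k , trans (sym (iter-cong f≗g k x)) eq

  record Orbits (f : X → X) (c : ℕ) : Set where
    field
      label            : X → Fin c
      label-surjective : ∀ i → ∃ λ x → label x ≡ i
      label-invariant  : ∀ x → label (f x) ≡ label x
      same-label⇒reach : ∀ {x y} → label x ≡ label y → Reach f x y

    reach⇒same-label : ∀ {x y} → Reach f x y → label x ≡ label y
    reach⇒same-label = reach-invariant label label-invariant

    representative : Fin c → X
    representative i = proj₁ (label-surjective i)

  orbits-cong : {f g : X → X} → f ≗ g → ∀ {c} → Orbits f c → Orbits g c
  orbits-cong f≗g O = record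
    { label            = label
    ; label-surjective = label-surjective
    ; label-invariant  = λ x → trans (cong label (sym (f≗g x))) (label-invariant x)
    ; same-label⇒reach = reach-cong f≗g ∘ same-label⇒reach
    }
    where open Orbits O

  orbits-unique : {f : X → X} {c c′ : ℕ} → Orbits f c → Orbits f c′ → c ≡ c′
  orbits-unique O O′ = cantor-schröder-bernstein (compare O O′) (compare O′ O)
    where
      compare : ∀ {f : X → X} {c c′} (O : Orbits f c) (O′ : Orbits f c′) →
                Injective _≡_ _≡_ (Orbits.label O′ ∘ Orbits.representative O)
      compare O O′ {i} {j} eq = begin
        i                  ≡⟨ sym (proj₂ (label-surjective i)) ⟩
        label (rep i)      ≡⟨ reach⇒same-label (Orbits.same-label⇒reach O′ eq) ⟩
        label (rep j)      ≡⟨ proj₂ (label-surjective j) ⟩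
        j                  ∎
        where
          open Orbits O renaming (representative to rep)
          open ≡-Reasoning

least-witness : (P : ℕ → Set) → (∀ i → Dec (P i)) → ∀ k → P k → ∃ λ j → P j × (∀ i → i < j → ¬ P i)
least-witness P P? zero    p = 0 , p , λ _ ()
least-witness P P? (suc k) p with P? 0 | least-witness (P ∘ suc) (P? ∘ suc) k p
... | yes p₀ | _             = 0 , p₀ , λ _ ()
... | no ¬p₀ | j , pj , below = suc j , pj , λ { zero _ → ¬p₀ ; (suc i) (s≤s i<j) → below i i<j }

module FiniteInjection {X : Set} {N : ℕ} (X↣Fin : X ↣ Fin N) where

  _≟_ : DecidableEquality X
  _≟_ = via-injection X↣Fin _≟ᶠ_

  module _ {f : X → X} (f-inj : Injective _≡_ _≡_ f) where

    return-time : ∀ x → ∃ λ p → iter (suc p) f x ≡ x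
    return-time x with pigeonhole ≤-refl (λ (i : Fin (suc N)) → Injection.to X↣Fin (iter (toℕ i) f x))
    ... | i , j , i<j , eq = d , sym (iter-injective f-inj (toℕ i) (begin
        iter (toℕ i) f x                        ≡⟨ Injection.injective X↣Fin eq ⟩
        iter (toℕ j) f x                        ≡⟨ cong (λ t → iter t f x) j≡i+d+1 ⟩
        iter (toℕ i + suc d) f x                ≡⟨ iter-+ f (toℕ i) (suc d) x ⟩
        iter (toℕ i) f (iter (suc d) f x)       ∎))
      where
        open ≡-Reasoning
        d = toℕ j ∸ suc (toℕ i)
        j≡i+d+1 : toℕ j ≡ toℕ i + suc d
        j≡i+d+1 = sym (trans (+-comm (toℕ i) (suc d)) (trans (sym (+-suc d (toℕ i))) (m∸n+n≡m i<j)))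

    iter-periodic : ∀ {p x} → iter (suc p) f x ≡ x → ∀ q → iter (q * suc p) f x ≡ x
    iter-periodic         eq zero    = refl
    iter-periodic {p} {x} eq (suc q) = trans (iter-+ f (suc p) (q * suc p) x)
                                             (trans (cong (iter (suc p) f) (iter-periodic eq q)) eq)

    reach-sym : ∀ {x y} → Reach f x y → Reach f y x
    reach-sym {x} (k , refl) with return-time x
    ... | p , eq = k * p , (begin
      iter (k * p) f (iter k f x)   ≡⟨ sym (iter-+ f (k * p) k x) ⟩
      iter (k * p + k) f x          ≡⟨ cong (λ t → iter t f x) (trans (+-comm (k * p) k) (sym (*-suc k p))) ⟩
      iter (k * suc p) f x          ≡⟨ iter-periodic eq k ⟩
      x                             ∎)
      where open ≡-Reasoning

    two-orbits : ∀ {x₁ x₂} → ¬ Reach f x₁ x₂ → (∀ x → Reach f x₁ x ⊎ Reach f x₂ x) → Orbits f 2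
    two-orbits {x₁} {x₂} apart cover = record
      { label            = side
      ; label-surjective = surjective
      ; label-invariant  = invariant
      ; same-label⇒reach = same-side⇒reach
      }
      where
        exclusive : ∀ {x} → Reach f x₁ x → ¬ Reach f x₂ x
        exclusive p q = apart (reach-trans p (reach-sym q))

        side : X → Fin 2
        side x with cover x
        ... | inj₁ _ = fzero
        ... | inj₂ _ = fsuc fzero

        side-x₁ : ∀ {x} → Reach f x₁ x → side x ≡ fzero
        side-x₁ {x} p with cover x
        ... | inj₁ _ = refl
        ... | inj₂ q = ⊥-elim (exclusive p q)

        side-x₂ : ∀ {x} → Reach f x₂ x → side x ≡ fsuc fzero
        side-x₂ {x} q with cover x
        ... | inj₁ p = ⊥-elim (exclusive p q)
        ... | inj₂ _ = refl

        surjective : ∀ i → ∃ λ x → side x ≡ i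
        surjective fzero        = x₁ , side-x₁ reach-refl
        surjective (fsuc fzero) = x₂ , side-x₂ reach-refl

        invariant : ∀ x → side (f x) ≡ side x
        invariant x with cover x
        ... | inj₁ p = side-x₁ (reach-step p)
        ... | inj₂ q = side-x₂ (reach-step q)

        same-side⇒reach : ∀ {x y} → side x ≡ side y → Reach f x y
        same-side⇒reach {x} {y} eq with cover x | cover y
        ... | inj₁ p | inj₁ q = reach-trans (reach-sym p) q
        ... | inj₂ p | inj₂ q = reach-trans (reach-sym p) q
        ... | inj₁ _ | inj₂ _ with () ← eq
        ... | inj₂ _ | inj₁ _ with () ← eq

-- Composing an injection with a transposition

module FinMerge {c : ℕ} (A B : Fin (suc c)) where

  redirect : Fin (suc c) → Fin (suc c)
  redirect u with u ≟ᶠ B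
  ... | yes _ = A
  ... | no  _ = u

  redirect-B : redirect B ≡ A
  redirect-B with B ≟ᶠ B
  ... | yes _   = refl
  ... | no B≢B = ⊥-elim (B≢B refl)

  redirect-≢B : ∀ {u} → u ≢ B → redirect u ≡ u
  redirect-≢B {u} u≢B with u ≟ᶠ B
  ... | yes u≡B = ⊥-elim (u≢B u≡B)
  ... | no  _   = refl

  module _ (A≢B : A ≢ B) where

    redirect≢B : ∀ u → redirect u ≢ B
    redirect≢B u with u ≟ᶠ B
    ... | yes _   = A≢B
    ... | no  u≢B = u≢B

    merge : Fin (suc c) → Fin c
    merge u = punchOut (redirect≢B u ∘ sym)

    merge-surjective : ∀ i → ∃ λ u → merge u ≡ i
    merge-surjective i = punchIn B i , trans (punchOut-cong B (redirect-≢B (punchInᵢ≢i B i))) (punchOut-punchIn B)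

    merge-injective : ∀ {u v} → merge u ≡ merge v → redirect u ≡ redirect v
    merge-injective {u} {v} = punchOut-injective {i = B} (redirect≢B u ∘ sym) (redirect≢B v ∘ sym)

    merge-cong : ∀ {u v} → redirect u ≡ redirect v → merge u ≡ merge v
    merge-cong = punchOut-cong B

module Transposition {X : Set} {N : ℕ} (X↣Fin : X ↣ Fin N) {f : X → X} (f-inj : Injective _≡_ _≡_ f) where

  open FiniteInjection X↣Fin

  -- f ∘ τ sends a to f b and then follows the f-orbit of b, which avoids a, back to b.
  reach-across : ∀ {c} (O : Orbits f c) {τ : X → X} {a b : X} → τ a ≡ b → (∀ z → z ≢ a → z ≢ b → τ z ≡ z) →
                 Orbits.label O a ≢ Orbits.label O b → Reach (f ∘ τ) a b
  reach-across O {τ} {a} {b} τa≡b τ-fixes la≢lb with return-time f-inj b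
  ... | p , returns with least-witness (λ i → iter (suc i) f b ≡ b) (λ i → iter (suc i) f b ≟ b) p returns
  ... | j , returns-at-j , j-least = suc j , trans (agree j ≤-refl) returns-at-j
    where
      open Orbits O
      agree : ∀ i → i ≤ j → iter (suc i) (f ∘ τ) a ≡ iter (suc i) f b
      agree zero    _     = cong f τa≡b
      agree (suc i) 1+i≤j = trans (cong (f ∘ τ) (agree i (<⇒≤ 1+i≤j)))
                                  (cong f (τ-fixes _ ≢a (j-least i 1+i≤j)))
        where
          ≢a : iter (suc i) f b ≢ a
          ≢a eq = la≢lb (trans (cong label (sym eq)) (sym (reach⇒same-label (suc i , refl))))

  module _ {τ : X → X} {a b : X} (a≢b : a ≢ b) (τa≡b : τ a ≡ b) (τb≡a : τ b ≡ a)
           (τ-fixes : ∀ z → z ≢ a → z ≢ b → τ z ≡ z) where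

    g : X → X
    g = f ∘ τ

    τ-involutive : ∀ z → τ (τ z) ≡ z
    τ-involutive z with z ≟ a | z ≟ b
    ... | yes refl | _        = trans (cong τ τa≡b) τb≡a
    ... | no _     | yes refl = trans (cong τ τb≡a) τa≡b
    ... | no z≢a   | no z≢b   = trans (cong τ (τ-fixes z z≢a z≢b)) (τ-fixes z z≢a z≢b)

    g-injective : Injective _≡_ _≡_ g
    g-injective {x} {y} eq = trans (sym (τ-involutive x)) (trans (cong τ (f-inj eq)) (τ-involutive y))

    g-a : g a ≡ f b
    g-a = cong f τa≡b

    g-b : g b ≡ f a
    g-b = cong f τb≡a

    g-elsewhere : ∀ {z} → z ≢ a → z ≢ b → g z ≡ f z
    g-elsewhere z≢a z≢b = cong f (τ-fixes _ z≢a z≢b)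

    module Merge {c : ℕ} (O : Orbits f (suc c)) (la≢lb : Orbits.label O a ≢ Orbits.label O b) where

      open Orbits O
      open FinMerge (label a) (label b)

      a⟶b : Reach g a b
      a⟶b = reach-across O τa≡b τ-fixes la≢lb

      b⟶a : Reach g b a
      b⟶a = reach-across O τb≡a (λ z z≢b z≢a → τ-fixes z z≢a z≢b) (la≢lb ∘ sym)

      f-step⇒g-reach : ∀ z → Reach g z (f z)
      f-step⇒g-reach z with z ≟ a | z ≟ b
      ... | yes refl | _        = subst (Reach g a) g-b (reach-step a⟶b)
      ... | no _     | yes refl = subst (Reach g b) g-a (reach-step b⟶a)
      ... | no z≢a   | no z≢b   = 1 , g-elsewhere z≢a z≢b

      f-reach⇒g-reach : ∀ {x y} → Reach f x y → Reach g x y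
      f-reach⇒g-reach (zero  , refl) = reach-refl
      f-reach⇒g-reach (suc k , refl) = reach-trans (f-reach⇒g-reach (k , refl)) (f-step⇒g-reach _)

      same-label⇒g-reach : ∀ {x y} → label x ≡ label y → Reach g x y
      same-label⇒g-reach = f-reach⇒g-reach ∘ same-label⇒reach

      redirect-label-invariant : ∀ z → redirect (label (g z)) ≡ redirect (label z)
      redirect-label-invariant z with z ≟ a | z ≟ b
      ... | yes refl | _        = begin
        redirect (label (g a))  ≡⟨ cong redirect (trans (cong label g-a) (label-invariant b)) ⟩
        redirect (label b)      ≡⟨ redirect-B ⟩
        label a                 ≡⟨ sym (redirect-≢B la≢lb) ⟩
        redirect (label a)      ∎
        where open ≡-Reasoning
      ... | no _     | yes refl = begin
        redirect (label (g b))  ≡⟨ cong redirect (trans (cong label g-b) (label-invariant a)) ⟩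
        redirect (label a)      ≡⟨ redirect-≢B la≢lb ⟩
        label a                 ≡⟨ sym redirect-B ⟩
        redirect (label b)      ∎
        where open ≡-Reasoning
      ... | no z≢a   | no z≢b   = cong redirect (trans (cong label (g-elsewhere z≢a z≢b)) (label-invariant z))

      same-redirect⇒reach : ∀ {x y} → redirect (label x) ≡ redirect (label y) → Reach g x y
      same-redirect⇒reach {x} {y} eq = by-cases (label x ≟ᶠ label b) (label y ≟ᶠ label b)
        where
          by-cases : Dec (label x ≡ label b) → Dec (label y ≡ label b) → Reach g x y
          by-cases (yes x∈B) (yes y∈B) = same-label⇒g-reach (trans x∈B (sym y∈B))
          by-cases (yes x∈B) (no  y∉B) = reach-trans (same-label⇒g-reach x∈B)
            (reach-trans b⟶a (same-label⇒g-reach (trans (sym (trans (cong redirect x∈B) redirect-B))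
                                                        (trans eq (redirect-≢B y∉B)))))
          by-cases (no  x∉B) (yes y∈B) = reach-trans (same-label⇒g-reach (trans (sym (redirect-≢B x∉B))
                                                        (trans eq (trans (cong redirect y∈B) redirect-B))))
            (reach-trans a⟶b (same-label⇒g-reach (sym y∈B)))
          by-cases (no  x∉B) (no  y∉B) = same-label⇒g-reach (trans (sym (redirect-≢B x∉B)) (trans eq (redirect-≢B y∉B)))

      merged : Orbits g c
      merged = record
        { label            = merge la≢lb ∘ label
        ; label-surjective = surjective
        ; label-invariant  = λ z → merge-cong la≢lb {label (g z)} {label z} (redirect-label-invariant z)
        ; same-label⇒reach = λ {x} {y} → same-redirect⇒reach ∘ merge-injective la≢lb {label x} {label y}
        }
        where
          surjective : ∀ i → ∃ λ x → merge la≢lb (label x) ≡ i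
          surjective i with merge-surjective la≢lb i
          ... | u , eq with label-surjective u
          ... | x , refl = x , eq

    module Split {c : ℕ} (O : Orbits f c) (la≡lb : Orbits.label O a ≡ Orbits.label O b) where

      open Orbits O

      first-arrival : ∃ λ j → iter (suc j) f a ≡ b × (∀ i → i < j → iter (suc i) f a ≢ b)
      first-arrival with same-label⇒reach la≡lb
      ... | zero  , a≡b = ⊥-elim (a≢b a≡b)
      ... | suc k , eq  = least-witness (λ i → iter (suc i) f a ≡ b) (λ i → iter (suc i) f a ≟ b) k eq

      j : ℕ
      j = proj₁ first-arrival

      arrives : iter (suc j) f a ≡ b
      arrives = proj₁ (proj₂ first-arrival)

      avoids-b : ∀ i → i < j → iter (suc i) f a ≢ b
      avoids-b = proj₂ (proj₂ first-arrival)

      avoids-a : ∀ i → i < j → iter (suc i) f a ≢ a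
      avoids-a i i<j eq = avoids-b r (subst (r <_) r+1+i≡j (m<m+n r (s≤s z≤n))) (begin
        iter (suc r) f a                   ≡⟨ cong (iter (suc r) f) (sym eq) ⟩
        iter (suc r) f (iter (suc i) f a)  ≡⟨ sym (iter-+ f (suc r) (suc i) a) ⟩
        iter (suc (r + suc i)) f a         ≡⟨ cong (λ t → iter (suc t) f a) r+1+i≡j ⟩
        iter (suc j) f a                   ≡⟨ arrives ⟩
        b                                  ∎)
        where
          open ≡-Reasoning
          r = j ∸ suc i
          r+1+i≡j : r + suc i ≡ j
          r+1+i≡j = m∸n+n≡m i<j

      g-on-path : ∀ i → i < j → g (iter (suc i) f a) ≡ iter (suc (suc i)) f a
      g-on-path i i<j = g-elsewhere (avoids-a i i<j) (avoids-b i i<j)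

      -- The arc f a, …, f^(j+1) a = b of the f-orbit of a closes up into a g-cycle, as g b = f a.
      Arc : X → Set
      Arc x = ∃ λ (i : Fin (suc j)) → iter (suc (toℕ i)) f a ≡ x

      arc? : ∀ x → Dec (Arc x)
      arc? x = any? (λ i → iter (suc (toℕ i)) f a ≟ x)

      arc : ∀ {i x} → i ≤ j → iter (suc i) f a ≡ x → Arc x
      arc i≤j eq = fromℕ< (s≤s i≤j) , trans (cong (λ t → iter (suc t) f a) (toℕ-fromℕ< (s≤s i≤j))) eq

      arc-index : ∀ {x} → Arc x → ∃ λ i → i ≤ j × iter (suc i) f a ≡ x
      arc-index (i , eq) = toℕ i , ≤-pred (toℕ<n i) , eq

      b∈arc : Arc b
      b∈arc = arc ≤-refl arrives

      a∉arc : ¬ Arc a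
      a∉arc s with arc-index s
      ... | i , i≤j , eq with m≤n⇒m<n∨m≡n i≤j
      ... | inj₁ i<j  = avoids-a i i<j eq
      ... | inj₂ refl = a≢b (trans (sym eq) arrives)

      g-walk : ∀ r i → r + i ≤ j → iter r g (iter (suc i) f a) ≡ iter (suc (r + i)) f a
      g-walk zero    i _   = refl
      g-walk (suc r) i r+i<j = trans (cong g (g-walk r i (<⇒≤ r+i<j))) (g-on-path (r + i) r+i<j)

      g-arc : ∀ {x} → Arc x → Arc (g x)
      g-arc s with arc-index s
      ... | i , i≤j , refl with m≤n⇒m<n∨m≡n i≤j
      ... | inj₁ i<j  = arc i<j (sym (g-on-path i i<j))
      ... | inj₂ refl = arc z≤n (sym (trans (cong g arrives) g-b))

      g-off-arc : ∀ {z} → ¬ Arc z → ¬ Arc (g z)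
      g-off-arc z∉arc s with arc-index s
      ... | zero  , _     , eq = z∉arc (subst Arc (g-injective (trans g-b eq)) b∈arc)
      ... | suc i , 1+i≤j , eq = z∉arc (arc (<⇒≤ 1+i≤j) (g-injective (trans (g-on-path i 1+i≤j) eq)))

      g-reach-off-arc : ∀ {x y} → ¬ Arc x → Reach g x y → ¬ Arc y
      g-reach-off-arc x∉arc (zero  , refl) = x∉arc
      g-reach-off-arc x∉arc (suc k , refl) = g-off-arc (g-reach-off-arc x∉arc (k , refl))

      arc⟶b : ∀ {x} → Arc x → Reach g x b
      arc⟶b s with arc-index s
      ... | i , i≤j , refl = j ∸ i , (begin
        iter (j ∸ i) g (iter (suc i) f a)  ≡⟨ g-walk (j ∸ i) i (≤-reflexive (m∸n+n≡m i≤j)) ⟩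
        iter (suc (j ∸ i + i)) f a         ≡⟨ cong (λ t → iter (suc t) f a) (m∸n+n≡m i≤j) ⟩
        iter (suc j) f a                   ≡⟨ arrives ⟩
        b                                  ∎)
        where open ≡-Reasoning

      b⟶arc : ∀ {y} → Arc y → Reach g b y
      b⟶arc s with arc-index s
      ... | i , i≤j , refl = suc i , (begin
        iter (suc i) g b            ≡⟨ iter-suc g i b ⟩
        iter i g (g b)              ≡⟨ cong (iter i g) g-b ⟩
        iter i g (f a)              ≡⟨ g-walk i 0 (subst (_≤ j) (sym (+-identityʳ i)) i≤j) ⟩
        iter (suc (i + 0)) f a      ≡⟨ cong (λ t → iter (suc t) f a) (+-identityʳ i) ⟩
        iter (suc i) f a            ∎)
        where open ≡-Reasoning

      -- An f-walk that starts off the arc can only enter it right after a, and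
      -- then the g-walk waits at a until the f-walk leaves the arc through b.
      off-arc-reach : ∀ {x} → ¬ Arc x → ∀ k → Reach g x (iter k f x) ⊎ (Arc (iter k f x) × Reach g x a)
      off-arc-reach x∉arc zero = inj₁ reach-refl
      off-arc-reach {x} x∉arc (suc k) with off-arc-reach x∉arc k | iter k f x ≟ a | iter k f x ≟ b
      ... | inj₁ r       | yes z≡a | _       = inj₂ (arc z≤n (cong f (sym z≡a)) , subst (Reach g x) z≡a r)
      ... | inj₁ r       | no _    | yes z≡b = ⊥-elim (g-reach-off-arc x∉arc r (subst Arc (sym z≡b) b∈arc))
      ... | inj₁ r       | no z≢a  | no z≢b  = inj₁ (subst (Reach g x) (g-elsewhere z≢a z≢b) (reach-step r))
      ... | inj₂ (s , r) | _       | yes z≡b = inj₁ (subst (Reach g x) (trans g-a (cong f (sym z≡b))) (reach-step r))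
      ... | inj₂ (s , r) | yes z≡a | no _    = ⊥-elim (a∉arc (subst Arc z≡a s))
      ... | inj₂ (s , r) | no z≢a  | no z≢b  = inj₂ (subst Arc (g-elsewhere z≢a z≢b) (g-arc s) , r)

      label-g-invariant : ∀ z → label (g z) ≡ label z
      label-g-invariant z with z ≟ a | z ≟ b
      ... | yes refl | _        = trans (cong label g-a) (trans (label-invariant b) (sym la≡lb))
      ... | no _     | yes refl = trans (cong label g-b) (trans (label-invariant a) la≡lb)
      ... | no z≢a   | no z≢b   = trans (cong label (g-elsewhere z≢a z≢b)) (label-invariant z)

      split-label : X → Fin (suc c)
      split-label x with arc? x
      ... | yes _ = fzero
      ... | no  _ = fsuc (label x)

      split-label-arc : ∀ {x} → Arc x → split-label x ≡ fzero
      split-label-arc {x} s with arc? x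
      ... | yes _ = refl
      ... | no  x∉arc = ⊥-elim (x∉arc s)

      split-label-off : ∀ {x} → ¬ Arc x → split-label x ≡ fsuc (label x)
      split-label-off {x} x∉arc with arc? x
      ... | yes s = ⊥-elim (x∉arc s)
      ... | no  _ = refl

      split : Orbits g (suc c)
      split = record
        { label            = split-label
        ; label-surjective = surjective
        ; label-invariant  = invariant
        ; same-label⇒reach = λ {x} {y} eq → same⇒reach eq (arc? x) (arc? y)
        }
        where
          invariant : ∀ z → split-label (g z) ≡ split-label z
          invariant z with arc? z
          ... | yes s     = split-label-arc (g-arc s)
          ... | no  z∉arc = trans (split-label-off (g-off-arc z∉arc)) (cong fsuc (label-g-invariant z))

          same⇒reach : ∀ {x y} → split-label x ≡ split-label y → Dec (Arc x) → Dec (Arc y) → Reach g x y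
          same⇒reach eq (yes sx) (yes sy) = reach-trans (arc⟶b sx) (b⟶arc sy)
          same⇒reach eq (yes sx) (no ny)  = ⊥-elim (0≢1+n (trans (sym (split-label-arc sx)) (trans eq (split-label-off ny))))
          same⇒reach eq (no nx)  (yes sy) = ⊥-elim (0≢1+n (trans (sym (split-label-arc sy)) (trans (sym eq) (split-label-off nx))))
          same⇒reach {x} eq (no nx) (no ny)
            with same-label⇒reach (suc-injective (trans (sym (split-label-off nx)) (trans eq (split-label-off ny))))
          ... | k , fᵏx≡y with off-arc-reach nx k
          ... | inj₁ r       = subst (Reach g x) fᵏx≡y r
          ... | inj₂ (s , _) = ⊥-elim (ny (subst Arc fᵏx≡y s))

          surjective : ∀ i → ∃ λ x → split-label x ≡ i
          surjective fzero = b , split-label-arc b∈arc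
          surjective (fsuc i) with label-surjective i
          ... | x , refl with arc? x
          ... | no  x∉arc = x , split-label-off x∉arc
          ... | yes s with arc-index s
          ... | k , _ , refl = a , trans (split-label-off a∉arc) (cong fsuc (reach⇒same-label (suc k , refl)))

    orbits-transpose : ∀ {c} → Orbits f c → ∃ λ c′ → Orbits g c′ × (c′ ≡ suc c ⊎ c ≡ suc c′)
    orbits-transpose {zero}  O = ⊥-elim (¬Fin0 (Orbits.label O a))
    orbits-transpose {suc c} O with Orbits.label O a ≟ᶠ Orbits.label O b
    ... | yes la≡lb = suc (suc c) , Split.split O la≡lb , inj₁ refl
    ... | no  la≢lb = c , Merge.merged O la≢lb , inj₂ refl

-- Parity and sums

double%4≡0⇔even : ∀ k → ((k + k) % 4 ≡ 0) ⇔ (parity k ≡ 0ℙ)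
double%4≡0⇔even 0             = mk⇔ (λ _ → refl) (λ _ → refl)
double%4≡0⇔even 1             = mk⇔ (λ ()) (λ ())
double%4≡0⇔even (suc (suc k)) = subst (λ r → (r ≡ 0) ⇔ (parity k ≡ 0ℙ)) (sym shift) (double%4≡0⇔even k)
  where
    shift : (suc (suc k) + suc (suc k)) % 4 ≡ (k + k) % 4
    shift = trans (cong (_% 4) (trans (cong (λ t → 2 + t) (trans (+-suc k (suc k)) (cong suc (+-suc k k))))
                                      (+-comm 4 (k + k))))
                  ([m+n]%n≡m%n (k + k) 4)

even⇒2∣ : ∀ k → parity k ≡ 0ℙ → 2 ∣ k
even⇒2∣ 0             _    = divides 0 refl
even⇒2∣ (suc (suc k)) even with even⇒2∣ k even
... | divides q k≡q*2 = divides (suc q) (cong (2 +_) k≡q*2)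

odd⇒1ℙ : ∀ {p} → p ≢ 0ℙ → p ≡ 1ℙ
odd⇒1ℙ {0ℙ} p≢0 = ⊥-elim (p≢0 refl)
odd⇒1ℙ {1ℙ} _   = refl

parity-+-middle : ∀ l k s → parity (l + (k + s)) ≡ parity k +ℙ parity (l + s)
parity-+-middle l k s = trans (cong parity (+-comm-middle l k s)) (+-homo-+ k (l + s))
  where
    +-comm-middle : ∀ l k s → l + (k + s) ≡ k + (l + s)
    +-comm-middle l k s = trans (sym (+-assoc l k s)) (trans (cong (_+ s) (+-comm l k)) (+-assoc k l s))

module _ {A : Set} {P : A → Set} (P? : ∀ x → Dec (P x)) (K : A → ℕ)
         (P⇔even : ∀ x → P x ⇔ (parity (K x) ≡ 0ℙ)) where

  -- Each x is counted once on the left: by the filter when K x is even, by the parity of K x when it is odd.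
  parity-count+sum : ∀ xs → parity (length (filter P? xs) + sum (map K xs)) ≡ parity (length xs)
  parity-count+sum []       = refl
  parity-count+sum (x ∷ xs) with P? x
  ... | yes px = begin
    parity (suc (l + (K x + s)))            ≡⟨ +-homo-+ 1 (l + (K x + s)) ⟩
    1ℙ +ℙ parity (l + (K x + s))            ≡⟨ cong (1ℙ +ℙ_) (parity-+-middle l (K x) s) ⟩
    1ℙ +ℙ (parity (K x) +ℙ parity (l + s))  ≡⟨ cong (λ p → 1ℙ +ℙ (p +ℙ parity (l + s))) (Equivalence.to (P⇔even x) px) ⟩
    1ℙ +ℙ parity (l + s)                    ≡⟨ cong (1ℙ +ℙ_) (parity-count+sum xs) ⟩
    1ℙ +ℙ parity (length xs)                ≡⟨ sym (+-homo-+ 1 (length xs)) ⟩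
    parity (suc (length xs))                ∎
    where
      open ≡-Reasoning
      l = length (filter P? xs)
      s = sum (map K xs)
  ... | no ¬px = begin
    parity (l + (K x + s))                  ≡⟨ parity-+-middle l (K x) s ⟩
    parity (K x) +ℙ parity (l + s)          ≡⟨ cong₂ _+ℙ_ (odd⇒1ℙ (¬px ∘ Equivalence.from (P⇔even x))) (parity-count+sum xs) ⟩
    1ℙ +ℙ parity (length xs)                ≡⟨ sym (+-homo-+ 1 (length xs)) ⟩
    parity (suc (length xs))                ∎
    where
      open ≡-Reasoning
      l = length (filter P? xs)
      s = sum (map K xs)

parity-suc-cong : ∀ {x y} → parity x ≡ parity y → parity (suc x) ≡ parity (suc y)
parity-suc-cong {x} {y} eq = trans (+-homo-+ 1 x) (trans (cong (1ℙ +ℙ_) eq) (sym (+-homo-+ 1 y)))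

parity-±1 : ∀ {x y} → y ≡ suc x ⊎ x ≡ suc y → parity y ≡ parity (suc x)
parity-±1 (inj₁ refl) = refl
parity-±1 (inj₂ refl) = refl

p+q≡r⇒r+q≡0⇒p≡0 : ∀ p q {r} → p +ℙ q ≡ r → r +ℙ q ≡ 0ℙ → p ≡ 0ℙ
p+q≡r⇒r+q≡0⇒p≡0 0ℙ _  _    _  = refl
p+q≡r⇒r+q≡0⇒p≡0 1ℙ 0ℙ refl ()
p+q≡r⇒r+q≡0⇒p≡0 1ℙ 1ℙ refl ()

δ : ∀ {k} → Fin k → Fin k → ℕ
δ x v with x ≟ᶠ v
... | yes _ = 1
... | no  _ = 0

δ-suc : ∀ {k} (x v : Fin k) → δ (fsuc x) (fsuc v) ≡ δ x v
δ-suc x v with x ≟ᶠ v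
... | yes _ = refl
... | no  _ = refl

∑-δ : ∀ {k} (x : Fin k) → ∑ (δ x) ≡ 1
∑-δ {suc k} fzero    = cong suc (sum-replicate-zero k)
∑-δ {suc k} (fsuc x) = trans (sum-cong-≗ (δ-suc x)) (∑-δ x)

∑-1 : ∀ k → ∑ {k} (λ _ → 1) ≡ k
∑-1 zero    = refl
∑-1 (suc k) = cong suc (∑-1 k)

sum-tabulate : ∀ {k} (g : Fin k → ℕ) → sum (tabulate g) ≡ ∑ g
sum-tabulate {zero}  g = refl
sum-tabulate {suc k} g = cong (g fzero +_) (sum-tabulate (g ∘ fsuc))

sum-map-allFin : ∀ {k} (g : Fin k → ℕ) → sum (map g (allFin k)) ≡ ∑ g
sum-map-allFin g = trans (cong sum (map-tabulate id g)) (sum-tabulate g)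

-- Orientable embeddings

-- `degree` counts ends through a helper local to its definition; exposing the
-- summand as a Σ makes it available for pointwise reasoning.
degree-summand : (G : Graph) (v : Fin (n G)) → Σ (Fin (m G) → ℕ) λ F → degree G v ≡ sum (map F (allFin (m G)))
degree-summand G v = _ , refl

degree-summand-δ : (G : Graph) (v : Fin (n G)) (e : Fin (m G)) →
                   proj₁ (degree-summand G v) e ≡ δ (ends G e false) v + δ (ends G e true) v
degree-summand-δ G v e with ends G e false ≟ᶠ v | ends G e true ≟ᶠ v
... | yes _ | yes _ = refl
... | yes _ | no  _ = refl
... | no  _ | yes _ = refl
... | no  _ | no  _ = refl

degree-as-∑ : (G : Graph) (v : Fin (n G)) → degree G v ≡ ∑ (λ e → δ (ends G e false) v + δ (ends G e true) v)
degree-as-∑ G v = trans (proj₂ (degree-summand G v))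
                        (trans (sum-map-allFin (proj₁ (degree-summand G v))) (sum-cong-≗ (degree-summand-δ G v)))

dart↣Fin : (G : Graph) → Dart G ↣ Fin (m G * 2)
dart↣Fin G = ↔⇒↣ (↔-trans (↔-refl ×-↔ ↔-sym 2↔Bool) (↔-sym *↔×))

module EdgeReversal (G : Graph) where

  reverse-edge : ℕ → Dart G → Dart G
  reverse-edge k (e , b) with toℕ e ≟ℕ k
  ... | yes _ = θ G (e , b)
  ... | no  _ = e , b

  reverse-edges-below : ℕ → Dart G → Dart G
  reverse-edges-below zero    = id
  reverse-edges-below (suc k) = reverse-edges-below k ∘ reverse-edge k

  reverse-edges-below-≥ : ∀ k e b → k ≤ toℕ e → reverse-edges-below k (e , b) ≡ (e , b)
  reverse-edges-below-≥ zero    e b _ = refl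
  reverse-edges-below-≥ (suc k) e b k<e with toℕ e ≟ℕ k
  ... | yes e≡k = ⊥-elim (<-irrefl (sym e≡k) k<e)
  ... | no  _   = reverse-edges-below-≥ k e b (<⇒≤ k<e)

  reverse-edges-below-< : ∀ k e b → toℕ e < k → reverse-edges-below k (e , b) ≡ θ G (e , b)
  reverse-edges-below-< (suc k) e b e<1+k with toℕ e ≟ℕ k
  ... | yes e≡k = reverse-edges-below-≥ k e (not b) (≤-reflexive (sym e≡k))
  ... | no  e≢k with m<1+n⇒m<n∨m≡n e<1+k
  ...   | inj₁ e<k = reverse-edges-below-< k e b e<k
  ...   | inj₂ e≡k = ⊥-elim (e≢k e≡k)

  reverse-all-edges : reverse-edges-below (m G) ≗ θ G
  reverse-all-edges (e , b) = reverse-edges-below-< (m G) e b (toℕ<n e)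

  ends-differ : ∀ {e : Fin (m G)} → (e , false) ≢ (e , true)
  ends-differ ()

  module _ {k : ℕ} (k<m : k < m G) where

    edge : Fin (m G)
    edge = fromℕ< k<m

    reverse-edge-false : reverse-edge k (edge , false) ≡ (edge , true)
    reverse-edge-false with toℕ edge ≟ℕ k
    ... | yes _     = refl
    ... | no  e≢k   = ⊥-elim (e≢k (toℕ-fromℕ< k<m))

    reverse-edge-true : reverse-edge k (edge , true) ≡ (edge , false)
    reverse-edge-true with toℕ edge ≟ℕ k
    ... | yes _     = refl
    ... | no  e≢k   = ⊥-elim (e≢k (toℕ-fromℕ< k<m))

    reverse-edge-fixes : ∀ z → z ≢ (edge , false) → z ≢ (edge , true) → reverse-edge k z ≡ z
    reverse-edge-fixes (e , b) z≢f z≢t with toℕ e ≟ℕ k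
    ... | no  _   = refl
    ... | yes e≡k with toℕ-injective (trans e≡k (sym (toℕ-fromℕ< k<m)))
    reverse-edge-fixes (e , false) z≢f z≢t | yes _ | refl = ⊥-elim (z≢f refl)
    reverse-edge-fixes (e , true)  z≢f z≢t | yes _ | refl = ⊥-elim (z≢t refl)

  module _ {f : Dart G → Dart G} (f-inj : Injective _≡_ _≡_ f) where

    reversing-injective : ∀ k → k ≤ m G → Injective _≡_ _≡_ (f ∘ reverse-edges-below k)
    reversing-injective zero    _   = f-inj
    reversing-injective (suc k) k<m = Transposition.g-injective (dart↣Fin G) (reversing-injective k (<⇒≤ k<m))
      ends-differ (reverse-edge-false k<m) (reverse-edge-true k<m) (reverse-edge-fixes k<m)

    orbits-reversing : ∀ {c} → Orbits f c → ∀ k → k ≤ m G →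
                       ∃ λ c′ → Orbits (f ∘ reverse-edges-below k) c′ × parity c′ ≡ parity (c + k)
    orbits-reversing {c} O zero    _   = c , O , cong parity (sym (+-identityʳ c))
    orbits-reversing {c} O (suc k) k<m with orbits-reversing O k (<⇒≤ k<m)
    ... | c₀ , O₀ , c₀≡c+k with Transposition.orbits-transpose (dart↣Fin G) (reversing-injective k (<⇒≤ k<m))
                                  ends-differ (reverse-edge-false k<m) (reverse-edge-true k<m) (reverse-edge-fixes k<m) O₀
    ... | c′ , O′ , c′≡c₀±1 = c′ , O′ , trans (parity-±1 c′≡c₀±1)
                                   (trans (parity-suc-cong {c₀} {c + k} c₀≡c+k) (cong parity (sym (+-suc c k))))

    orbits-∘θ : ∀ {c} → Orbits f c → ∃ λ c′ → Orbits (f ∘ θ G) c′ × parity c′ ≡ parity (c + m G)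
    orbits-∘θ O with orbits-reversing O (m G) ≤-refl
    ... | c′ , O′ , eq = c′ , orbits-cong (cong f ∘ reverse-all-edges) O′ , eq

module _ {G : Graph} (R : RotationSystem G) where

  open FiniteInjection (dart↣Fin G) using (reach-sym; two-orbits)

  ρ-injective : Injective _≡_ _≡_ (ρ R)
  ρ-injective {x} {y} eq = trans (sym (ρ-inv₁ R x)) (trans (cong (ρ⁻¹ R) eq) (ρ-inv₁ R y))

  θ-involutive : ∀ d → θ G (θ G d) ≡ d
  θ-involutive (e , b) = cong (e ,_) (not-involutive b)

  φ-injective : Injective _≡_ _≡_ (φ R)
  φ-injective {x} {y} eq = trans (sym (θ-involutive x)) (trans (cong (θ G) (ρ-injective eq)) (θ-involutive y))

  vertex-orbits : (∀ v → ∃ λ d → base G d ≡ v) → Orbits (ρ R) (n G)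
  vertex-orbits has-dart = record
    { label            = base G
    ; label-surjective = has-dart
    ; label-invariant  = ρ-local R
    ; same-label⇒reach = ρ-cyclic R _ _
    }

  face-orbits : ∀ {d₁ d₂} → TwoFaces R d₁ d₂ → Orbits (φ R) 2
  face-orbits (apart , cover) = two-orbits φ-injective apart cover

  n+m-even : ∀ {d₁ d₂} → (∀ v → ∃ λ d → base G d ≡ v) → TwoFaces R d₁ d₂ → parity (n G + m G) ≡ 0ℙ
  n+m-even has-dart two-faces with EdgeReversal.orbits-∘θ G ρ-injective (vertex-orbits has-dart)
  ... | c , O , c≡n+m = trans (sym c≡n+m) (cong parity (orbits-unique O (face-orbits two-faces)))

  module EulerianFace {d₀ : Dart G} (euler : EulerFace R d₀) where

    forward : Fin (m G) → Bool
    forward e with proj₁ euler e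
    ... | inj₁ _ = false
    ... | inj₂ _ = true

    face-dart : Fin (m G) → Dart G
    face-dart e = e , forward e

    face-dart-on-face : ∀ e → SameFace R d₀ (face-dart e)
    face-dart-on-face e with proj₁ euler e
    ... | inj₁ (on , _) = on
    ... | inj₂ (on , _) = on

    on-face⇒face-dart : ∀ {e b} → SameFace R d₀ (e , b) → (e , b) ≡ face-dart e
    on-face⇒face-dart {e} {b} on with proj₁ euler e
    on-face⇒face-dart {e} {false} on | inj₁ _        = refl
    on-face⇒face-dart {e} {true}  on | inj₁ (_ , off) = ⊥-elim (off on)
    on-face⇒face-dart {e} {false} on | inj₂ (_ , off) = ⊥-elim (off on)
    on-face⇒face-dart {e} {true}  on | inj₂ _        = refl

    has-dart : ∀ v → ∃ λ d → base G d ≡ v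
    has-dart v with proj₂ euler v
    ... | d , _ , d-at-v = d , d-at-v

    next-edge : Fin (m G) → Fin (m G)
    next-edge e = proj₁ (φ R (face-dart e))

    φ-face-dart : ∀ e → φ R (face-dart e) ≡ face-dart (next-edge e)
    φ-face-dart e = on-face⇒face-dart (reach-step (face-dart-on-face e))

    φ⁻¹ : Dart G → Dart G
    φ⁻¹ d = θ G (ρ⁻¹ R d)

    φ-φ⁻¹ : ∀ d → φ R (φ⁻¹ d) ≡ d
    φ-φ⁻¹ d = trans (cong (ρ R) (θ-involutive (ρ⁻¹ R d))) (ρ-inv₂ R d)

    φ⁻¹-φ : ∀ d → φ⁻¹ (φ R d) ≡ d
    φ⁻¹-φ d = trans (cong (θ G) (ρ-inv₁ R (θ G d))) (θ-involutive d)

    prev-edge : Fin (m G) → Fin (m G)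
    prev-edge e = proj₁ (φ⁻¹ (face-dart e))

    φ⁻¹-face-dart : ∀ e → φ⁻¹ (face-dart e) ≡ face-dart (prev-edge e)
    φ⁻¹-face-dart e = on-face⇒face-dart (reach-trans (face-dart-on-face e) (reach-sym φ-injective (1 , φ-φ⁻¹ _)))

    next-prev : ∀ e → next-edge (prev-edge e) ≡ e
    next-prev e = cong proj₁ (trans (cong (φ R) (sym (φ⁻¹-face-dart e))) (φ-φ⁻¹ (face-dart e)))

    prev-next : ∀ e → prev-edge (next-edge e) ≡ e
    prev-next e = cong proj₁ (trans (cong φ⁻¹ (sym (φ-face-dart e))) (φ⁻¹-φ (face-dart e)))

    tail head : Fin (m G) → Fin (n G)
    tail e = base G (face-dart e)
    head e = base G (θ G (face-dart e))

    head≡tail∘next : ∀ e → head e ≡ tail (next-edge e)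
    head≡tail∘next e = sym (trans (cong (base G) (sym (φ-face-dart e))) (ρ-local R _))

    half-degree : Fin (n G) → ℕ
    half-degree v = ∑ (λ e → δ (tail e) v)

    ends-δ : ∀ v e → δ (ends G e false) v + δ (ends G e true) v ≡ δ (tail e) v + δ (head e) v
    ends-δ v e with forward e
    ... | false = refl
    ... | true  = +-comm (δ (ends G e false) v) (δ (ends G e true) v)

    degree≡half+half : ∀ v → degree G v ≡ half-degree v + half-degree v
    degree≡half+half v = begin
      degree G v                                            ≡⟨ degree-as-∑ G v ⟩
      ∑ (λ e → δ (ends G e false) v + δ (ends G e true) v)  ≡⟨ sum-cong-≗ (ends-δ v) ⟩
      ∑ (λ e → δ (tail e) v + δ (head e) v)                 ≡⟨ ∑-distrib-+ (λ e → δ (tail e) v) (λ e → δ (head e) v) ⟩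
      half-degree v + ∑ (λ e → δ (head e) v)                ≡⟨ cong (half-degree v +_) (sum-cong-≗ (λ e → cong (λ x → δ x v) (head≡tail∘next e))) ⟩
      half-degree v + ∑ (λ e → δ (tail (next-edge e)) v)    ≡⟨ cong (half-degree v +_) (sym (sum-permute (λ e → δ (tail e) v) next-permutation)) ⟩
      half-degree v + half-degree v                         ∎
      where
        open ≡-Reasoning
        next-permutation : Permutation′ (m G)
        next-permutation = permutation next-edge prev-edge next-prev prev-next

    ∑-half-degree : ∑ half-degree ≡ m G
    ∑-half-degree = trans (∑-comm (λ v e → δ (tail e) v)) (trans (sum-cong-≗ (λ e → ∑-δ (tail e))) (∑-1 (m G)))

    count0mod4+m≡n : parity (count0mod4 G + m G) ≡ parity (n G)
    count0mod4+m≡n = begin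
      parity (count0mod4 G + m G)                                      ≡⟨ cong (λ s → parity (count0mod4 G + s)) (sym (trans (sum-map-allFin half-degree) ∑-half-degree)) ⟩
      parity (count0mod4 G + sum (map half-degree (allFin (n G))))     ≡⟨ parity-count+sum (λ v → degree G v % 4 ≟ℕ 0) half-degree P⇔even (allFin (n G)) ⟩
      parity (length (allFin (n G)))                                   ≡⟨ cong parity (length-tabulate {n = n G} id) ⟩
      parity (n G)                                                     ∎
      where
        open ≡-Reasoning
        P⇔even : ∀ v → (degree G v % 4 ≡ 0) ⇔ (parity (half-degree v) ≡ 0ℙ)
        P⇔even v = subst (λ d → (d % 4 ≡ 0) ⇔ (parity (half-degree v) ≡ 0ℙ)) (sym (degree≡half+half v)) (double%4≡0⇔even (half-degree v))

  eulerian-face-conclusion : ∀ {d₁ d₂} → TwoFaces R d₁ d₂ → EulerFace R d₁ → Conclusion G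
  eulerian-face-conclusion two-faces euler =
      even⇒2∣ (count0mod4 G) (p+q≡r⇒r+q≡0⇒p≡0 (parity (count0mod4 G)) (parity (m G))
        (trans (sym (+-homo-+ (count0mod4 G) (m G))) count0mod4+m≡n)
        (trans (sym (+-homo-+ (n G) (m G))) n+m≡0))
    , even⇒2∣ (m G + n G) (trans (cong parity (+-comm (m G) (n G))) n+m≡0)
    where
      open EulerianFace euler
      n+m≡0 : parity (n G + m G) ≡ 0ℙ
      n+m≡0 = n+m-even has-dart two-faces

proposition3p2 : (G : Graph) → (OrientableBiEulerian G → Conclusion G) × (OrientableDirectedBiEulerian G → Conclusion G)
proposition3p2 G = bi-eulerian , directed-bi-eulerian
  where
    bi-eulerian : OrientableBiEulerian G → Conclusion G
    bi-eulerian (R , _ , _ , two-faces , euler , _) = eulerian-face-conclusion R two-faces euler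

    directed-bi-eulerian : OrientableDirectedBiEulerian G → Conclusion G
    directed-bi-eulerian (R , _ , _ , two-faces , (euler , _) , _) = eulerian-face-conclusion R two-faces euler
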